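{- Let $\mathcal M=(D,M)$ be a $\mathrm{3LQST_0}$-interpretation, $D^*\subseteq D$, $d^*\in D^*$, $\mathcal V_0'\subseteq\mathcal V_0$, $\mathcal V_1'\subseteq\mathcal V_1$, $l>0$, and let $\mathcal M^*=(D^*,M^*)=\mathrm{Rel}(\mathcal M,D^*,d^*,\mathcal V_0',\mathcal V_1',l)$ be such that for every $X\in\mathcal V_1'$, $M^*X=MX$ if $|MX|\le l$ and $|M^*X|>l$ otherwise. Let $(\forall z_1)\dots(\forall z_n)\varphi_0$ be a purely universal $\mathrm{3LQST_0}^R$-formula of level 0 such that (i) $Mx\in D^*$ for every $x\in\mathcal V_0$ occurring free in it; (ii) every finite enumeration $\{x_1,\dots,x_k\}$ occurring in it has $k\le l$; (iii) $z_1,\dots,z_n\in\mathcal V_0\setminus\mathcal V_0'$; (iv) $M^*X=MX$ for every set variable $X$ occurring in it with $X\in\mathcal V_1\setminus\mathcal V_1'$. Then $\mathcal M\models(\forall z_1)\dots(\forall z_n)\varphi_0$ implies $\mathcal M^*\models(\forall z_1)\dots(\forall z_n)\varphi_0$.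
   Context: Variables: $\mathcal V_0$ (individual), $\mathcal V_1$ (set), $\mathcal V_2$ (collection). Level-0 atoms: $x=y$, $x\in X$, $\{x_1,\dots,x_k\}=X$, $\{x_1,\dots,x_k\}\in A$. A purely universal formula of level 0 is $(\forall z_1)\dots(\forall z_n)\varphi_0$ with $n\ge1$, $z_i\in\mathcal V_0$, $\varphi_0$ a propositional combination of level-0 atoms. A $\mathrm{3LQST_0}$-interpretation is $(D,M)$ with $D\ne\emptyset$, $Mx\in D$, $MX\subseteq D$, $MA\subseteq\mathrm{pow}(D)$; $\{x_1,\dots,x_k\}$ denotes $\{Mx_1,\dots,Mx_k\}$; $(\forall z)$ ranges over the domain. Relativized interpretation: $\mathrm{Rel}(\mathcal M,D^*,d^*,\mathcal V_0',\mathcal V_1',l)=(D^*,M^*)$ with $M^*x=Mx$ if $Mx\in D^*$, else $d^*$; $M^*X=MX\cap D^*$; $M^*A=\big((MA\cap\mathrm{pow}(D^*))\setminus(\{M^*X:X\in\mathcal V_1'\}\cup\mathrm{pow}_{\le l}(S))\big)\cup\{M^*X:X\in\mathcal V_1',MX\in MA\}\cup(\mathrm{pow}_{\le l}(S)\cap MA)$, $S=\{M^*x:x\in\mathcal V_0'\}$, $\mathrm{pow}_{\le l}(S)$ the subsets of $S$ with at most $l$ elements. -}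

module Defs where

open import Level using (Level; 0ℓ; Lift; lift) renaming (suc to lsuc)
open import Data.Nat using (ℕ; _≤_; _≟_)
open import Data.List using (List; []; _∷_; map; _++_; length)
open import Data.List.NonEmpty using (List⁺; toList) renaming (length to length⁺)
open import Data.List.Membership.Propositional using (_∈_)
open import Data.Product using (Σ; ∃; _×_; _,_; proj₁; proj₂)
open import Data.Sum using (_⊎_; inj₁; inj₂)
open import Relation.Nullary using (¬_; Dec; yes; no)
open import Relation.Unary using (Decidable)
open import Relation.Binary.PropositionalEquality using (_≡_; refl)

-- Syntax.  Individual variables (V₀), set variables (V₁) and
-- collection variables (V₂) are each indexed by ℕ.

Var₀ Var₁ Var₂ : Set
Var₀ = ℕ
Var₁ = ℕ
Var₂ = ℕ

-- level-0 atoms; an enumeration {x₁,…,x_k} is a nonempty list (k ≥ 1)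
data Atom : Set where
  eqA     : Var₀ → Var₀ → Atom
  memA    : Var₀ → Var₁ → Atom
  enumEqA : List⁺ Var₀ → Var₁ → Atom
  enumInA : List⁺ Var₀ → Var₂ → Atom

data Form₀ : Set where
  atom : Atom → Form₀
  ¬ᶠ_   : Form₀ → Form₀
  _∧ᶠ_  : Form₀ → Form₀ → Form₀
  _∨ᶠ_  : Form₀ → Form₀ → Form₀
  _⇒ᶠ_  : Form₀ → Form₀ → Form₀

record PUForm : Set where
  constructor ∀[_]_
  field
    bound : List⁺ Var₀
    body  : Form₀
open PUForm public

atomInd : Atom → List Var₀
atomInd (eqA x y)      = x ∷ y ∷ []
atomInd (memA x X)     = x ∷ []
atomInd (enumEqA xs X) = toList xs
atomInd (enumInA xs A) = toList xs

atomSet : Atom → List Var₁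
atomSet (eqA x y)      = []
atomSet (memA x X)     = X ∷ []
atomSet (enumEqA xs X) = X ∷ []
atomSet (enumInA xs A) = []

atomEnums : Atom → List (List⁺ Var₀)
atomEnums (eqA x y)      = []
atomEnums (memA x X)     = []
atomEnums (enumEqA xs X) = xs ∷ []
atomEnums (enumInA xs A) = xs ∷ []

collect : {B : Set} → (Atom → List B) → Form₀ → List B
collect f (atom a)  = f a
collect f (¬ᶠ φ)    = collect f φ
collect f (φ ∧ᶠ ψ)  = collect f φ ++ collect f ψ
collect f (φ ∨ᶠ ψ)  = collect f φ ++ collect f ψ
collect f (φ ⇒ᶠ ψ)  = collect f φ ++ collect f ψ

indVars : Form₀ → List Var₀
indVars = collect atomInd

setVars : Form₀ → List Var₁
setVars = collect atomSet

enums : Form₀ → List (List⁺ Var₀)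
enums = collect atomEnums

-- Semantics.  All domains live in an ambient carrier type U; a domain
-- is a subset D of U, sets are predicates on U, collections are
-- predicates on sets.  Set identity is extensional.

module _ {U : Set} where

  _≐_ : (U → Set) → (U → Set) → Set
  S ≐ T = ∀ u → (S u → T u) × (T u → S u)

  _⊆_ : (U → Set) → (U → Set) → Set
  S ⊆ T = ∀ u → S u → T u

  _∈ᶜ_ : (U → Set) → ((U → Set) → Set₁) → Set₁
  T ∈ᶜ C = ∃ λ T′ → C T′ × (T′ ≐ T)

  AtMost : ℕ → (U → Set) → Set
  AtMost l T = ∃ λ (us : List U) → length us ≤ l × (∀ u → T u → u ∈ us)

record Interp (U : Set) : Set₂ where
  field
    Dom    : U → Set
    nonemp : ∃ Dom
    ind    : Var₀ → U
    ind∈   : ∀ x → Dom (ind x)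
    set    : Var₁ → U → Set
    set⊆   : ∀ X → set X ⊆ Dom
    col    : Var₂ → (U → Set) → Set₁
    col⊆   : ∀ A T → col A T → T ⊆ Dom
open Interp public

module _ {U : Set} where

  enumSet : Interp U → List⁺ Var₀ → U → Set
  enumSet M xs u = u ∈ map (ind M) (toList xs)

  ⟦_⟧ᵃ : Atom → Interp U → Set₁
  ⟦ eqA x y ⟧ᵃ M      = Lift (lsuc 0ℓ) (ind M x ≡ ind M y)
  ⟦ memA x X ⟧ᵃ M     = Lift (lsuc 0ℓ) (set M X (ind M x))
  ⟦ enumEqA xs X ⟧ᵃ M = Lift (lsuc 0ℓ) (enumSet M xs ≐ set M X)
  ⟦ enumInA xs A ⟧ᵃ M = enumSet M xs ∈ᶜ col M A

  ⟦_⟧ : Form₀ → Interp U → Set₁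
  ⟦ atom a ⟧ M  = ⟦ a ⟧ᵃ M
  ⟦ ¬ᶠ φ ⟧ M    = ¬ ⟦ φ ⟧ M
  ⟦ φ ∧ᶠ ψ ⟧ M  = ⟦ φ ⟧ M × ⟦ ψ ⟧ M
  ⟦ φ ∨ᶠ ψ ⟧ M  = ⟦ φ ⟧ M ⊎ ⟦ ψ ⟧ M
  ⟦ φ ⇒ᶠ ψ ⟧ M  = ⟦ φ ⟧ M → ⟦ ψ ⟧ M

  update : (M : Interp U) → Var₀ → (u : U) → Dom M u → Interp U
  update M z u u∈ = record
    { Dom = Dom M ; nonemp = nonemp M
    ; ind = λ x → upd x (x ≟ z)
    ; ind∈ = λ x → upd∈ x (x ≟ z)
    ; set = set M ; set⊆ = set⊆ M ; col = col M ; col⊆ = col⊆ M }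
    where
    upd : ∀ x → Dec (x ≡ z) → U
    upd x (yes _) = u
    upd x (no _)  = ind M x
    upd∈ : ∀ x d → Dom M (upd x d)
    upd∈ x (yes _) = u∈
    upd∈ x (no _)  = ind∈ M x

  satAll : Interp U → List Var₀ → Form₀ → Set₁
  satAll M []       φ = ⟦ φ ⟧ M
  satAll M (z ∷ zs) φ = ∀ u (u∈ : Dom M u) → satAll (update M z u u∈) zs φ

  _⊨_ : Interp U → PUForm → Set₁
  M ⊨ F = satAll M (toList (bound F)) (body F)

-- Relativized interpretation Rel(M, D*, d*, V₀′, V₁′, l).
-- The decidability of D* is only needed to define M*x (a classical
-- case distinction); the lemma supplies it via excluded middle.

module _ {U : Set} (M : Interp U) (D* : U → Set) (D*? : Decidable D*)
         (d* : U) (d*∈ : D* d*) (V₀′ : Var₀ → Set) (V₁′ : Var₁ → Set)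
         (l : ℕ) where

  relInd : Var₀ → U
  relInd x with D*? (ind M x)
  ... | yes _ = ind M x
  ... | no _  = d*

  relInd∈ : ∀ x → D* (relInd x)
  relInd∈ x with D*? (ind M x)
  ... | yes p = p
  ... | no _  = d*∈

  relSet : Var₁ → U → Set
  relSet X u = set M X u × D* u

  Sᴿ : U → Set
  Sᴿ u = ∃ λ x → V₀′ x × relInd x ≡ u

  PowLe : (U → Set) → Set
  PowLe T = T ⊆ Sᴿ × AtMost l T

  ImgV₁ : (U → Set) → Set
  ImgV₁ T = ∃ λ X → V₁′ X × (T ≐ relSet X)

  relCol : Var₂ → (U → Set) → Set₁
  relCol A T =
      ((T ∈ᶜ col M A × T ⊆ D*) × ¬ Lift (lsuc 0ℓ) (ImgV₁ T ⊎ PowLe T))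
    ⊎ (∃ λ X → V₁′ X × (T ≐ relSet X) × (set M X ∈ᶜ col M A))
    ⊎ (Lift (lsuc 0ℓ) (PowLe T) × T ∈ᶜ col M A)

  relCol⊆ : ∀ A T → relCol A T → T ⊆ D*
  relCol⊆ A T (inj₁ ((_ , T⊆) , _)) = T⊆
  relCol⊆ A T (inj₂ (inj₁ (X , _ , T≐ , _))) u Tu =
    proj₂ (proj₁ (T≐ u) Tu)
  relCol⊆ A T (inj₂ (inj₂ (lift (T⊆S , _) , _))) u Tu
    with T⊆S u Tu
  ... | x , _ , refl = relInd∈ x

  Rel : Interp U
  Rel = record
    { Dom = D* ; nonemp = d* , d*∈
    ; ind = relInd ; ind∈ = relInd∈
    ; set = relSet ; set⊆ = λ X u p → proj₂ p
    ; col = relCol ; col⊆ = relCol⊆ }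

module Submission where

-- Call a set variable X faithful if M*X = MX whenever |M*X| ≤ l.  The
-- hypotheses make every V₁′-variable faithful (using excluded middle on
-- |MX| ≤ l) and every other set variable of the formula trivially so.
-- The heart of the proof is that, for a finite set T ⊆ D* with |T| ≤ l,
--   * T = MX  ⇔  T = M*X         for every faithful X, and
--   * T ∈ MA  ⇔  T ∈ M*A         for every collection variable A,
-- the second by the three clauses defining M*A.  Since enumerations have
-- at most l elements, each atom, and then by induction each propositional
-- combination, has the same truth value in M and M* under any two
-- assignments that agree on its individual variables (and send them into
-- D* on the M* side).  Finally the quantifier prefix is peeled off: an
-- element of D* is also one of D, so every M*-instance of the prefix is an
-- M-instance.

open import Defs
open import Level using (0ℓ; Lift; lift) renaming (suc to lsuc)
open import Data.Nat using (ℕ; _≤_; _<_; _≟_)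
open import Data.List using (List; []; _∷_; map; _++_; length)
open import Data.List.NonEmpty using (List⁺; toList) renaming (length to length⁺)
open import Data.List.Membership.Propositional using (_∈_; _∉_)
open import Data.List.Membership.Propositional.Properties using (∈-map⁻)
open import Data.List.Relation.Unary.All using (All; []; _∷_; head; tabulate)
open import Data.List.Relation.Unary.All.Properties using (++⁻ˡ; ++⁻ʳ)
open import Data.List.Relation.Unary.Any using (here; there)
open import Data.List.Properties using (length-map; map-cong-local)
open import Data.Product using (_×_; _,_; proj₁; proj₂)
open import Data.Product.Function.NonDependent.Propositional using (_×-⇔_)
open import Data.Sum using (inj₁; inj₂)
open import Data.Sum.Function.Propositional using (_⊎-⇔_)
open import Data.Empty using (⊥-elim)
open import Function.Bundles using (_⇔_; mk⇔; Equivalence)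
open import Function.Construct.Identity using (⇔-id)
open import Function.Related.TypeIsomorphisms using (→-cong-⇔; ¬-cong-⇔)
open import Relation.Nullary using (¬_; yes; no)
open import Relation.Unary using (Decidable)
open import Relation.Binary.PropositionalEquality using (_≡_; refl; sym; subst)
open import Axiom.ExcludedMiddle using (ExcludedMiddle)

open Equivalence using (to; from)

module _ {U : Set} where

  ≐-refl : {S : U → Set} → S ≐ S
  ≐-refl u = (λ p → p) , (λ p → p)

  ≐-sym : {S T : U → Set} → S ≐ T → T ≐ S
  ≐-sym e u = proj₂ (e u) , proj₁ (e u)

  ≐-trans : {S T R : U → Set} → S ≐ T → T ≐ R → S ≐ R
  ≐-trans e f u = (λ p → proj₁ (f u) (proj₁ (e u) p))
                , (λ p → proj₂ (e u) (proj₂ (f u) p))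

  ≐⇒⊆ : {S T : U → Set} → S ≐ T → S ⊆ T
  ≐⇒⊆ e u = proj₁ (e u)

  ∈ᶜ-resp-≐ : {S T : U → Set} {C : (U → Set) → Set₁} → S ∈ᶜ C → S ≐ T → T ∈ᶜ C
  ∈ᶜ-resp-≐ (S′ , S′∈C , S′≐S) S≐T = S′ , S′∈C , ≐-trans S′≐S S≐T

  atMost-⊆ : ∀ {l} {S T : U → Set} → AtMost l S → T ⊆ S → AtMost l T
  atMost-⊆ (us , len≤l , S⊆us) T⊆S = us , len≤l , λ u t → S⊆us u (T⊆S u t)

  atMost-map : ∀ {l} {A : Set} (f : A → U) (xs : List A) → length xs ≤ l →
               AtMost l (λ u → u ∈ map f xs)
  atMost-map f xs len≤l =
    map f xs , subst (_≤ _) (sym (length-map f xs)) len≤l , λ u i → i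

-- M with its individual assignment replaced by f; the interpretations
-- reached by the quantifier prefix are all of this form.
reassign : {U : Set} (M : Interp U) (f : Var₀ → U) → (∀ x → Dom M (f x)) → Interp U
reassign M f f∈ = record
  { Dom = Dom M ; nonemp = nonemp M ; ind = f ; ind∈ = f∈
  ; set = set M ; set⊆ = set⊆ M ; col = col M ; col⊆ = col⊆ M }

lift-⇔ : ∀ {a ℓ} {A B : Set a} → A ⇔ B → Lift ℓ A ⇔ Lift ℓ B
lift-⇔ A⇔B = mk⇔ (λ { (lift a) → lift (to A⇔B a) }) (λ { (lift b) → lift (from A⇔B b) })

module Relativization {U : Set} (M : Interp U) (D* : U → Set) (D*? : Decidable D*)
    (d* : U) (d*∈ : D* d*) (V₀′ : Var₀ → Set) (V₁′ : Var₁ → Set) (l : ℕ) where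

  M* : Interp U
  M* = Rel M D* D*? d* d*∈ V₀′ V₁′ l

  relInd-agrees : ∀ x → D* (ind M x) → ind M* x ≡ ind M x
  relInd-agrees x Mx∈D* with D*? (ind M x)
  ... | yes _    = refl
  ... | no Mx∉D* = ⊥-elim (Mx∉D* Mx∈D*)

  Faithful : Var₁ → Set
  Faithful X = AtMost l (set M* X) → set M* X ≐ set M X

  faithful-by-size : ExcludedMiddle 0ℓ → ∀ X →
    (AtMost l (set M X) → set M* X ≐ set M X) →
    (¬ AtMost l (set M X) → ¬ AtMost l (set M* X)) → Faithful X
  faithful-by-size lem X small large M*X-small with lem {AtMost l (set M X)}
  ... | yes MX-small = small MX-small
  ... | no  MX-large = ⊥-elim (large MX-large M*X-small)

  module Transfer (lem : ExcludedMiddle 0ℓ) (faithful-V₁′ : ∀ X → V₁′ X → Faithful X) where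

    set-transfer : ∀ {T : U → Set} X → AtMost l T → Faithful X →
                   (T ≐ set M X) ⇔ (T ≐ set M* X)
    set-transfer {T} X T-small faithful = mk⇔
      (λ T≐MX → ≐-trans T≐MX (≐-sym (faithful (small-if (≐-sym T≐MX) (λ _ → proj₁)))))
      (λ T≐M*X → ≐-trans T≐M*X (faithful (small-if (≐-sym T≐M*X) (λ _ p → p))))
      where
      small-if : ∀ {S} → S ≐ T → set M* X ⊆ S → AtMost l (set M* X)
      small-if S≐T M*X⊆S = atMost-⊆ T-small λ u p → ≐⇒⊆ S≐T u (M*X⊆S u p)

    collection-transfer : ∀ {T : U → Set} A → T ⊆ D* → AtMost l T →
                          (T ∈ᶜ col M A) ⇔ (T ∈ᶜ col M* A)
    collection-transfer {T} A T⊆D* T-small = mk⇔ into back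
      where
      faithful-image : ∀ {S} X → V₁′ X → S ≐ set M* X → S ≐ T → set M* X ≐ set M X
      faithful-image X X∈V₁′ S≐M*X S≐T =
        faithful-V₁′ X X∈V₁′ (atMost-⊆ T-small λ u p → ≐⇒⊆ S≐T u (proj₂ (S≐M*X u) p))

      into : T ∈ᶜ col M A → T ∈ᶜ col M* A
      into T∈MA with lem {PowLe M D* D*? d* d*∈ V₀′ V₁′ l T}
      ... | yes T∈pow = T , inj₂ (inj₂ (lift T∈pow , T∈MA)) , ≐-refl
      ... | no T∉pow with lem {ImgV₁ M D* D*? d* d*∈ V₀′ V₁′ l T}
      ...   | yes (X , X∈V₁′ , T≐M*X) =
                T , inj₂ (inj₁ (X , X∈V₁′ , T≐M*X , ∈ᶜ-resp-≐ T∈MA T≐MX)) , ≐-refl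
                where
                T≐MX = ≐-trans T≐M*X (faithful-image X X∈V₁′ T≐M*X ≐-refl)
      ...   | no T∉img =
                T , inj₁ ((T∈MA , T⊆D*) , λ { (lift (inj₁ img)) → T∉img img
                                            ; (lift (inj₂ pow)) → T∉pow pow }) , ≐-refl

      back : T ∈ᶜ col M* A → T ∈ᶜ col M A
      back (T′ , inj₁ ((T′∈MA , _) , _) , T′≐T) = ∈ᶜ-resp-≐ T′∈MA T′≐T
      back (T′ , inj₂ (inj₁ (X , X∈V₁′ , T′≐M*X , MX∈MA)) , T′≐T) =
        ∈ᶜ-resp-≐ MX∈MA (≐-trans (≐-sym (faithful-image X X∈V₁′ T′≐M*X T′≐T))
                                 (≐-trans (≐-sym T′≐M*X) T′≐T))
      back (T′ , inj₂ (inj₂ (_ , T′∈MA)) , T′≐T) = ∈ᶜ-resp-≐ T′∈MA T′≐T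

    record Admissible (f g : Var₀ → U) (xs : List Var₀) (Xs : List Var₁)
                      (es : List (List⁺ Var₀)) : Set₁ where
      field
        agree    : All (λ x → f x ≡ g x) xs
        faithful : All Faithful Xs
        short    : All (λ e → length⁺ e ≤ l) es
    open Admissible

    AdmissibleFor : (f g : Var₀ → U) → Form₀ → Set₁
    AdmissibleFor f g φ = Admissible f g (indVars φ) (setVars φ) (enums φ)

    leftPart : ∀ {f g xs xs′ Xs Xs′ es es′} →
      Admissible f g (xs ++ xs′) (Xs ++ Xs′) (es ++ es′) → Admissible f g xs Xs es
    leftPart {xs = xs} {Xs = Xs} {es = es} adm =
      record { agree = ++⁻ˡ xs (agree adm) ; faithful = ++⁻ˡ Xs (faithful adm)
             ; short = ++⁻ˡ es (short adm) }

    rightPart : ∀ {f g xs′ Xs′ es′} (φ : Form₀) →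
      Admissible f g (indVars φ ++ xs′) (setVars φ ++ Xs′) (enums φ ++ es′) →
      Admissible f g xs′ Xs′ es′
    rightPart φ adm =
      record { agree = ++⁻ʳ (indVars φ) (agree adm)
             ; faithful = ++⁻ʳ (setVars φ) (faithful adm)
             ; short = ++⁻ʳ (enums φ) (short adm) }

    module _ (f : Var₀ → U) (f∈ : ∀ x → Dom M (f x))
             (g : Var₀ → U) (g∈ : ∀ x → D* (g x)) where

      N N* : Interp U
      N  = reassign M f f∈
      N* = reassign M* g g∈

      listed⊆D* : (xs : List Var₀) → (λ u → u ∈ map g xs) ⊆ D*
      listed⊆D* xs u u∈gxs with ∈-map⁻ g u∈gxs
      ... | x , _ , refl = g∈ x

      atom-transfer : (a : Atom) → Admissible f g (atomInd a) (atomSet a) (atomEnums a) →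
                      ⟦ a ⟧ᵃ N ⇔ ⟦ a ⟧ᵃ N*
      atom-transfer (eqA x y) adm with agree adm
      ... | fx≡gx ∷ fy≡gy ∷ [] rewrite fx≡gx | fy≡gy = ⇔-id _
      atom-transfer (memA x X) adm with agree adm
      ... | fx≡gx ∷ [] rewrite fx≡gx =
        lift-⇔ (mk⇔ (λ p → p , g∈ x) proj₁)
      atom-transfer (enumEqA xs X) adm
        rewrite map-cong-local (agree adm) =
        lift-⇔ (set-transfer X (atMost-map g (toList xs) len≤l) X-faithful)
        where
        X-faithful = head (faithful adm)
        len≤l = head (short adm)
      atom-transfer (enumInA xs A) adm
        rewrite map-cong-local (agree adm) =
        collection-transfer A (listed⊆D* (toList xs))
          (atMost-map g (toList xs) (head (short adm)))

      formula-transfer : (φ : Form₀) → AdmissibleFor f g φ → ⟦ φ ⟧ N ⇔ ⟦ φ ⟧ N*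
      formula-transfer (atom a) adm = atom-transfer a adm
      formula-transfer (¬ᶠ φ) adm = ¬-cong-⇔ (formula-transfer φ adm)
      formula-transfer (φ ∧ᶠ ψ) adm =
        formula-transfer φ (leftPart adm) ×-⇔ formula-transfer ψ (rightPart φ adm)
      formula-transfer (φ ∨ᶠ ψ) adm =
        formula-transfer φ (leftPart adm) ⊎-⇔ formula-transfer ψ (rightPart φ adm)
      formula-transfer (φ ⇒ᶠ ψ) adm =
        →-cong-⇔ (formula-transfer φ (leftPart adm)) (formula-transfer ψ (rightPart φ adm))

    prefix-transfer : D* ⊆ Dom M → (zs : List Var₀) (φ : Form₀) →
      All Faithful (setVars φ) → All (λ e → length⁺ e ≤ l) (enums φ) →
      (f : Var₀ → U) (f∈ : ∀ x → Dom M (f x)) (g : Var₀ → U) (g∈ : ∀ x → D* (g x)) →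
      (∀ x → x ∈ indVars φ → x ∉ zs → f x ≡ g x) →
      satAll (reassign M f f∈) zs φ → satAll (reassign M* g g∈) zs φ
    prefix-transfer D*⊆D [] φ faithfulφ shortφ f f∈ g g∈ agreeφ =
      to (formula-transfer f f∈ g g∈ φ record
        { agree = tabulate (λ {x} x∈φ → agreeφ x x∈φ λ ()) ; faithful = faithfulφ ; short = shortφ })
    prefix-transfer D*⊆D (z ∷ zs) φ faithfulφ shortφ f f∈ g g∈ agreeφ sat u u∈D* =
      prefix-transfer D*⊆D zs φ faithfulφ shortφ (ind Nᶻ) (ind∈ Nᶻ) (ind N*ᶻ) (ind∈ N*ᶻ)
        agree-updated (sat u (D*⊆D u u∈D*))
      where
      Nᶻ  = update (reassign M f f∈) z u (D*⊆D u u∈D*)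
      N*ᶻ = update (reassign M* g g∈) z u u∈D*
      agree-updated : ∀ x → x ∈ indVars φ → x ∉ zs → ind Nᶻ x ≡ ind N*ᶻ x
      agree-updated x x∈φ x∉zs with x ≟ z
      ... | yes _   = refl
      ... | no  x≢z = agreeφ x x∈φ λ { (here x≡z) → x≢z x≡z ; (there x∈zs) → x∉zs x∈zs }

lemma3p7 : (lem₀ : ExcludedMiddle 0ℓ) (lem₁ : ExcludedMiddle (lsuc 0ℓ))
    {U : Set} (M : Interp U) (D* : U → Set) (D*⊆D : D* ⊆ Dom M)
    (d* : U) (d*∈ : D* d*) (V₀′ : ℕ → Set) (V₁′ : ℕ → Set) (l : ℕ) → 0 < l →
    let M* = Rel M D* (λ u → lem₀) d* d*∈ V₀′ V₁′ l in
    (∀ X → V₁′ X →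
      (AtMost l (set M X) → set M* X ≐ set M X)
      × (¬ AtMost l (set M X) → ¬ AtMost l (set M* X))) →
    (F : PUForm) →
    (∀ x → x ∈ indVars (body F) → x ∉ toList (bound F) → D* (ind M x)) →
    (∀ xs → xs ∈ enums (body F) → length⁺ xs ≤ l) →
    (∀ z → z ∈ toList (bound F) → ¬ V₀′ z) →
    (∀ X → X ∈ setVars (body F) → ¬ V₁′ X → set M* X ≐ set M X) →
    M ⊨ F → M* ⊨ F
lemma3p7 lem₀ _ M D* D*⊆D d* d*∈ V₀′ V₁′ l _ V₁′-sizes F free∈D* short _ fixed =
  prefix-transfer D*⊆D (toList (bound F)) (body F) faithfulF (tabulate (short _))
    (ind M) (ind∈ M) (ind M*) (ind∈ M*)
    (λ x x∈F x-free → sym (relInd-agrees x (free∈D* x x∈F x-free)))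
  where
  open Relativization M D* (λ _ → lem₀) d* d*∈ V₀′ V₁′ l
  faithful-V₁′ : ∀ X → V₁′ X → Faithful X
  faithful-V₁′ X X∈V₁′ = faithful-by-size lem₀ X (proj₁ (V₁′-sizes X X∈V₁′))
                                                 (proj₂ (V₁′-sizes X X∈V₁′))
  open Transfer lem₀ faithful-V₁′
  faithful-set-var : ∀ X → X ∈ setVars (body F) → Faithful X
  faithful-set-var X X∈F with lem₀ {V₁′ X}
  ... | yes X∈V₁′ = faithful-V₁′ X X∈V₁′
  ... | no  X∉V₁′ = λ _ → fixed X X∈F X∉V₁′
  faithfulF : All Faithful (setVars (body F))
  faithfulF = tabulate (faithful-set-var _)
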